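{- Let $G$ be a finite abelian group written in the canonical form $G=\bigoplus_{i=1}^{r}\bigoplus_{j=1}^{k_i} C_{p_i^{a_{i,j}}}$, where $p_1<\dots<p_r$ are primes and $a_{i,1}\ge a_{i,2}\ge\dots\ge a_{i,k_i}\ge 1$ (with $a_{i,j}=0$ for $j>k_i$). Let $n$ be a positive integer and suppose $a_{i,n}>a_{i,n+1}$ for some $i\in[1,r]$. Let $l$ be a positive integer divisible by $p_i^{a_{i,n+1}+1}$. If $S$ is a dense zero-sum free sequence over $G$, then $S$ contains at most $\eta(C_{p_i}^n)-1$ elements (counted with multiplicity) of order $l$.
   Context: A sequence over $G$ is a finite unordered sequence of elements of $G$ with repetition allowed; $|S|$ is its length. $S$ is zero-sum free if no nonempty subsequence sums to $0$. The cross number is $\mathsf{k}(S)=\sum_{g}v_g(S)/\operatorname{ord}(g)$, where $v_g(S)$ is the multiplicity of $g$ in $S$; $\mathsf{k}(G)$ is the maximum cross number of a zero-sum free sequence over $G$. A zero-sum free sequence $S$ over $G$ is dense if $\mathsf{k}(S)=\mathsf{k}(G)$ and $|S|$ is minimal among all zero-sum free sequences $T$ over $G$ with $\mathsf{k}(T)=\mathsf{k}(G)$. For a finite abelian group $H$, $\eta(H)$ is the smallest integer $t$ such that every sequence over $H$ of length at least $t$ has a nonempty zero-sum subsequence of length at most $\exp(H)$. $C_{p}^n$ denotes the direct sum of $n$ copies of $C_p$. -}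

module Defs where

open import Data.Nat using (ℕ; zero; suc; _+_; _*_; _∸_; _^_; _≤_; _<_)
open import Data.Nat.Divisibility using (_∣_; _∣?_)
open import Data.Nat.ListAction using (product)
open import Data.Fin using (Fin; toℕ)
open import Data.Fin.Properties using (all?)
open import Data.List using (List; []; _∷_; length; lookup; replicate; concatMap; map; allFin; foldr; upTo; filter)
open import Data.List.Relation.Binary.Sublist.Propositional using (_⊆_)
open import Data.Product using (Σ; _×_; ∃; _,_)
open import Data.Rational using (ℚ; 0ℚ) renaming (_+_ to _+ℚ_; _/_ to _/ℚ_; _≤_ to _≤ℚ_)
open import Data.Integer using (+_)
open import Relation.Nullary using (Dec; yes; no; ¬_)
open import Relation.Binary.PropositionalEquality using (_≡_)
open import Data.Nat using (_≟_)

-- A finite abelian group given as a direct sum of cyclic groups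
--   C_{m_0} ⊕ … ⊕ C_{m_{t-1}},   ms = [m_0, …, m_{t-1}].
-- An element is a tuple of residues (canonical representatives).
Elem : List ℕ → Set
Elem ms = (x : Fin (length ms)) → Fin (lookup ms x)

-- Sequences over G: finite lists (order irrelevant; subsequences = sublists).
Seq : List ℕ → Set
Seq ms = List (Elem ms)

Annihilates : (ms : List ℕ) → Elem ms → ℕ → Set
Annihilates ms g d = ∀ x → lookup ms x ∣ d * toℕ (g x)

annihilates? : (ms : List ℕ) (g : Elem ms) (d : ℕ) → Dec (Annihilates ms g d)
annihilates? ms g d = all? (λ x → lookup ms x ∣? (d * toℕ (g x)))

ZeroSum : (ms : List ℕ) → Seq ms → Set
ZeroSum ms S = ∀ x → lookup ms x ∣ foldr (λ g acc → toℕ (g x) + acc) 0 S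

NonEmpty : {A : Set} → List A → Set
NonEmpty xs = 1 ≤ length xs

ZeroSumFree : (ms : List ℕ) → Seq ms → Set
ZeroSumFree ms S = ∀ (T : Seq ms) → T ⊆ S → NonEmpty T → ¬ ZeroSum ms T

-- Order search: returns (least d ≥ suc d₀ with d·g = 0) minus one,
-- checking at most `fuel` candidates.
ordSearch : (ms : List ℕ) → Elem ms → (fuel d₀ : ℕ) → ℕ
ordSearch ms g zero d₀ = d₀
ordSearch ms g (suc fuel) d₀ with annihilates? ms g (suc d₀)
... | yes _ = d₀
... | no _  = ordSearch ms g fuel (suc d₀)

-- ord(g) = least positive d with d·g = 0.  Since |G| = product ms
-- annihilates every element, the search over [1, |G|] always succeeds.
ord : (ms : List ℕ) → Elem ms → ℕ
ord ms g = suc (ordSearch ms g (product ms) 0)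

cross : (ms : List ℕ) → Seq ms → ℚ
cross ms S = foldr (λ g acc → ((+ 1) /ℚ ord ms g) +ℚ acc) 0ℚ S

-- S is dense: zero-sum free, k(S) = k(G) (i.e. k(S) is the maximum cross
-- number of a zero-sum free sequence), and |S| minimal among zero-sum
-- free T with k(T) = k(G).
Dense : (ms : List ℕ) → Seq ms → Set
Dense ms S =
  ZeroSumFree ms S ×
  (∀ (T : Seq ms) → ZeroSumFree ms T → cross ms T ≤ℚ cross ms S) ×
  (∀ (T : Seq ms) → ZeroSumFree ms T → cross ms T ≡ cross ms S → length S ≤ length T)

countOrd : (ms : List ℕ) → Seq ms → ℕ → ℕ
countOrd ms S l = length (filter (λ g → ord ms g ≟ l) S)

Cpn : ℕ → ℕ → List ℕ
Cpn p n = replicate n p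

-- Property defining η(C_p^n) (n ≥ 1, so exp(C_p^n) = p): every sequence of
-- length ≥ t has a nonempty zero-sum subsequence of length ≤ p.
EtaProp : (p n t : ℕ) → Set
EtaProp p n t = ∀ (T : Seq (Cpn p n)) → t ≤ length T →
  Σ (Seq (Cpn p n)) λ U → U ⊆ T × NonEmpty U × length U ≤ p × ZeroSum (Cpn p n) U

IsEta : (p n e : ℕ) → Set
IsEta p n e = EtaProp p n e × (∀ t → EtaProp p n t → e ≤ t)

-- Canonical-form moduli list: [ p_i ^ a_{i,j} | i ∈ [1,r], j ∈ [1,k_i] ]
-- (index i is 0-based via Fin r; index j is 1-based).
canonMods : (r : ℕ) (p : Fin r → ℕ) (k : Fin r → ℕ) (a : Fin r → ℕ → ℕ) → List ℕ
canonMods r p k a = concatMap (λ i → map (λ j → p i ^ a i (suc j)) (upTo (k i))) (allFin r)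

module Submission where

-- Write l = L·p with p^c ∣ L.  The first n cyclic factors C_{p^{a_{i,j}}} (j ≤ n) of
-- the p-part of G have exponent a_{i,j} ≥ 1; every other factor C_m is "p-insensitive":
-- m ∣ L·p·t implies m ∣ L·t (m is a power of a different prime, or m ∣ p^c ∣ L).
-- For a term g of order l and j ≤ n, p^{a_{i,j}-1} divides L·g_j, and the quotients
-- taken mod p define a map ψ from the terms of order l into C_p^n.  If ψ sends a
-- nonempty subsequence V of at most p such terms to a zero-sum sequence, then L kills
-- the sum σ(V).  For |V| = 1 this contradicts ord g = l > L.  For |V| ≥ 2, replacing V
-- by σ(V) keeps S zero-sum free and does not decrease the cross number
-- (|V|/l ≤ 1/ord σ(V)), but shortens S, contradicting density.  So the ψ-image of the
-- terms of order l has no short zero-sum subsequence, and η(C_p^n) bounds their number.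

open import Defs
open import Algebra.Bundles using (CommutativeMonoid)
open import Algebra.Properties.CommutativeSemigroup using (x∙yz≈y∙xz)
open import Data.Empty using (⊥; ⊥-elim)
open import Data.Fin using (Fin; toℕ; zero; suc; fromℕ<; cast)
import Data.Fin
open import Data.Fin.Properties
  using (toℕ-fromℕ<; toℕ<n; toℕ-injective; toℕ-cast; cast-involutive; nonZeroIndex)
  renaming (<-cmp to <-cmpᶠ)
open import Data.Integer as ℤ using (ℤ)
import Data.Integer.Properties as ℤP
open import Data.Integer.Tactic.RingSolver using (solve-∀)
open import Data.List
  using (List; []; _∷_; length; lookup; map; foldr; filter; replicate; _++_; concatMap; tabulate; applyUpTo; upTo)
open import Data.List.Membership.Propositional.Properties using (∈-lookup)
open import Data.List.Properties using (length-map; length-replicate)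
open import Data.List.Relation.Binary.Sublist.Propositional using (_⊆_; []; _∷ʳ_; _∷_; ⊆-trans)
open import Data.List.Relation.Binary.Sublist.Propositional.Properties using (filter-⊆; All-resp-⊆)
open import Data.List.Relation.Unary.All as All using (All; []; _∷_)
open import Data.List.Relation.Unary.All.Properties using (all-filter)
open import Data.Nat
open import Data.Nat.Divisibility
open import Data.Nat.DivMod
open import Data.Nat.Primality using (Prime; euclidsLemma; prime⇒irreducible; prime⇒nonZero; prime⇒nonTrivial)
open import Data.Nat.ListAction using (product)
open import Data.Nat.ListAction.Properties using (∈⇒∣product)
open import Data.Nat.Properties
open import Data.Product using (Σ; ∃; _×_; _,_; proj₁; proj₂)
import Data.Rational as ℚ
open ℚ using (ℚ; 0ℚ; toℚᵘ)
import Data.Rational.Properties as ℚP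
open import Data.Rational.Unnormalised as ℚᵘ using (mkℚᵘ; *≡*; *≤*)
import Data.Rational.Unnormalised.Properties as ℚᵘP
open import Data.Sum using (_⊎_; inj₁; inj₂; [_,_])
open import Function using (id)
open import Relation.Binary.Definitions using (tri<; tri≈; tri>)
open import Relation.Binary.PropositionalEquality
  using (_≡_; _≢_; refl; sym; trans; cong; cong₂; subst; subst₂; ≢-sym; module ≡-Reasoning)
open import Relation.Nullary using (¬_; yes; no)

sumOver : {A : Set} → (A → ℕ) → List A → ℕ
sumOver f = foldr (λ x acc → f x + acc) 0

sumOver-map : {A B : Set} (f : B → ℕ) (h : A → B) (xs : List A) →
  sumOver f (map h xs) ≡ sumOver (λ x → f (h x)) xs
sumOver-map f h [] = refl
sumOver-map f h (x ∷ xs) = cong (f (h x) +_) (sumOver-map f h xs)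

sumOver-cong : {A : Set} {f f′ : A → ℕ} (xs : List A) →
  All (λ x → f x ≡ f′ x) xs → sumOver f xs ≡ sumOver f′ xs
sumOver-cong [] [] = refl
sumOver-cong (x ∷ xs) (e ∷ es) = cong₂ _+_ e (sumOver-cong xs es)

sumOver-*ˡ : {A : Set} (c : ℕ) (f : A → ℕ) (xs : List A) →
  sumOver (λ x → c * f x) xs ≡ c * sumOver f xs
sumOver-*ˡ c f [] = sym (*-zeroʳ c)
sumOver-*ˡ c f (x ∷ xs) =
  trans (cong (c * f x +_) (sumOver-*ˡ c f xs)) (sym (*-distribˡ-+ c (f x) (sumOver f xs)))

sumOver-∣ : {A : Set} {d : ℕ} (f : A → ℕ) (xs : List A) → All (λ x → d ∣ f x) xs → d ∣ sumOver f xs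
sumOver-∣ f [] [] = _ ∣0
sumOver-∣ f (x ∷ xs) (d∣ ∷ d∣s) = ∣m∣n⇒∣m+n d∣ (sumOver-∣ f xs d∣s)

*-pull-middle : ∀ m n o → (m * n) * o ≡ n * (m * o)
*-pull-middle m n o = trans (*-assoc m n o) (x∙yz≈y∙xz *-commutativeSemigroup m n o)

%-absorbˡ : ∀ a b d .{{_ : NonZero d}} → (a % d + b) % d ≡ (a + b) % d
%-absorbˡ a b d = begin
  (a % d + b) % d         ≡⟨ %-distribˡ-+ (a % d) b d ⟩
  (a % d % d + b % d) % d ≡⟨ cong (λ z → (z + b % d) % d) (m%n%n≡m%n a d) ⟩
  (a % d + b % d) % d     ≡⟨ %-distribˡ-+ a b d ⟨
  (a + b) % d             ∎
  where open ≡-Reasoning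

%-absorbʳ : ∀ a b d .{{_ : NonZero d}} → (a + b % d) % d ≡ (a + b) % d
%-absorbʳ a b d = begin
  (a + b % d) % d ≡⟨ cong (_% d) (+-comm a (b % d)) ⟩
  (b % d + a) % d ≡⟨ %-absorbˡ b a d ⟩
  (b + a) % d     ≡⟨ cong (_% d) (+-comm b a) ⟩
  (a + b) % d     ∎
  where open ≡-Reasoning

sumOver-% : {A : Set} (f : A → ℕ) (xs : List A) (d : ℕ) .{{_ : NonZero d}} →
  sumOver f xs % d ≡ sumOver (λ x → f x % d) xs % d
sumOver-% f [] d = refl
sumOver-% f (x ∷ xs) d = begin
  (f x + S) % d          ≡⟨ %-absorbʳ (f x) S d ⟨
  (f x + S % d) % d      ≡⟨ cong (λ z → (f x + z) % d) (sumOver-% f xs d) ⟩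
  (f x + S′ % d) % d     ≡⟨ %-absorbʳ (f x) S′ d ⟩
  (f x + S′) % d         ≡⟨ %-absorbˡ (f x) S′ d ⟨
  (f x % d + S′) % d     ∎
  where
  open ≡-Reasoning
  S = sumOver f xs
  S′ = sumOver (λ x → f x % d) xs

∣-sum-of-residues : {A : Set} (f : A → ℕ) (xs : List A) (d : ℕ) .{{_ : NonZero d}} →
  d ∣ sumOver (λ x → f x % d) xs → d ∣ sumOver f xs
∣-sum-of-residues f xs d d∣ =
  m%n≡0⇒n∣m _ d (trans (sumOver-% f xs d) (n∣m⇒m%n≡0 _ d d∣))

∣-%-+ : ∀ a b d .{{_ : NonZero d}} → d ∣ a % d + b → d ∣ a + b
∣-%-+ a b d d∣ = m%n≡0⇒n∣m _ d (trans (sym (%-absorbˡ a b d)) (n∣m⇒m%n≡0 _ d d∣))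

∣-*-% : ∀ c a d .{{_ : NonZero d}} → d ∣ c * a → d ∣ c * (a % d)
∣-*-% c a d d∣ = m%n≡0⇒n∣m _ d (begin
  (c * (a % d)) % d             ≡⟨ %-distribˡ-* c (a % d) d ⟩
  (c % d * (a % d % d)) % d     ≡⟨ cong (λ z → (c % d * z) % d) (m%n%n≡m%n a d) ⟩
  (c % d * (a % d)) % d         ≡⟨ %-distribˡ-* c a d ⟨
  (c * a) % d                   ≡⟨ n∣m⇒m%n≡0 _ d d∣ ⟩
  0                             ∎)
  where open ≡-Reasoning

ordSearch-minimal : ∀ ms g fuel d₀ d → d₀ ≤ d → Annihilates ms g (suc d) → ordSearch ms g fuel d₀ ≤ d
ordSearch-minimal ms g zero d₀ d d₀≤d an = d₀≤d
ordSearch-minimal ms g (suc fuel) d₀ d d₀≤d an with annihilates? ms g (suc d₀)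
... | yes _ = d₀≤d
... | no ¬an with m≤n⇒m<n∨m≡n d₀≤d
...   | inj₁ d₀<d = ordSearch-minimal ms g fuel (suc d₀) d d₀<d an
...   | inj₂ refl = ⊥-elim (¬an an)

ordSearch-sound : ∀ ms g fuel d₀ d → d₀ ≤ d → d < d₀ + fuel → Annihilates ms g (suc d) →
  Annihilates ms g (suc (ordSearch ms g fuel d₀))
ordSearch-sound ms g zero d₀ d d₀≤d d<d₀ an =
  ⊥-elim (<-irrefl refl (<-≤-trans d<d₀ (≤-trans (≤-reflexive (+-identityʳ d₀)) d₀≤d)))
ordSearch-sound ms g (suc fuel) d₀ d d₀≤d d<end an with annihilates? ms g (suc d₀)
... | yes an₀ = an₀
... | no ¬an with m≤n⇒m<n∨m≡n d₀≤d
...   | inj₁ d₀<d = ordSearch-sound ms g fuel (suc d₀) d d₀<d (<-≤-trans d<end (≤-reflexive (+-suc d₀ fuel))) an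
...   | inj₂ refl = ⊥-elim (¬an an)

ord-minimal : ∀ ms g d .{{_ : NonZero d}} → Annihilates ms g d → ord ms g ≤ d
ord-minimal ms g (suc d) an = s≤s (ordSearch-minimal ms g (product ms) 0 d z≤n an)

nonZeroModuli : (ms : List ℕ) → Elem ms → ∀ x → NonZero (lookup ms x)
nonZeroModuli ms g x = nonZeroIndex (g x)

product-nonZero : ∀ ms → Elem ms → NonZero (product ms)
product-nonZero [] g = _
product-nonZero (m ∷ ms) g =
  m*n≢0 m (product ms) {{nonZeroIndex (g zero)}} {{product-nonZero ms (λ x → g (suc x))}}

-- ord g annihilates g: the search range [1, |G|] contains the annihilator |G|.
ord-annihilates : ∀ ms g → Annihilates ms g (ord ms g)
ord-annihilates ms g =
  ordSearch-sound ms g |G| 0 (pred |G|) z≤n (≤-reflexive (suc-pred |G|))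
    (subst (Annihilates ms g) (sym (suc-pred |G|)) |G|-annihilates)
  where
  |G| = product ms
  instance
    |G|≢0 : NonZero |G|
    |G|≢0 = product-nonZero ms g
  |G|-annihilates : Annihilates ms g |G|
  |G|-annihilates x = ∣m⇒∣m*n (toℕ (g x)) (∈⇒∣product (∈-lookup {xs = ms} x))

ord≡⇒annihilates : ∀ ms g {d} → ord ms g ≡ d → Annihilates ms g d
ord≡⇒annihilates ms g refl = ord-annihilates ms g

module _ {A : Set} where

  complement : {V S : List A} → V ⊆ S → List A
  complement [] = []
  complement (y ∷ʳ τ) = y ∷ complement τ
  complement (_ ∷ τ) = complement τ

  complement-⊆ : {V S : List A} (τ : V ⊆ S) → complement τ ⊆ S
  complement-⊆ [] = []
  complement-⊆ (y ∷ʳ τ) = refl ∷ complement-⊆ τ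
  complement-⊆ (_ ∷ τ) = _ ∷ʳ complement-⊆ τ

  length-complement : {V S : List A} (τ : V ⊆ S) → length S ≡ length V + length (complement τ)
  length-complement [] = refl
  length-complement {V} (y ∷ʳ τ) = trans (cong suc (length-complement τ)) (sym (+-suc (length V) _))
  length-complement (refl ∷ τ) = cong suc (length-complement τ)

  recombine : {V S T : List A} (τ : V ⊆ S) → T ⊆ complement τ →
    Σ (List A) λ R → R ⊆ S × length V ≤ length R × (∀ f → sumOver f R ≡ sumOver f V + sumOver f T)
  recombine [] [] = [] , [] , z≤n , λ f → refl
  recombine (y ∷ʳ τ) (.y ∷ʳ σ) with recombine τ σ
  ... | R , ρ , V≤R , sums = R , y ∷ʳ ρ , V≤R , sums
  recombine {V} (y ∷ʳ τ) (refl ∷ σ) with recombine τ σ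
  ... | R , ρ , V≤R , sums = y ∷ R , refl ∷ ρ , m≤n⇒m≤1+n V≤R ,
      λ f → trans (cong (f y +_) (sums f)) (x∙yz≈y∙xz +-commutativeSemigroup (f y) (sumOver f V) _)
  recombine {x ∷ V} {T = T} (refl ∷ τ) σ with recombine τ σ
  ... | R , ρ , V≤R , sums = x ∷ R , refl ∷ ρ , s≤s V≤R ,
      λ f → trans (cong (f x +_) (sums f)) (sym (+-assoc (f x) (sumOver f V) (sumOver f T)))

  pullback-map : {B : Set} (h : A → B) {U : List B} (xs : List A) → U ⊆ map h xs →
    Σ (List A) λ V → V ⊆ xs × map h V ≡ U
  pullback-map h [] [] = [] , [] , refl
  pullback-map h (x ∷ xs) (_ ∷ʳ σ) with pullback-map h xs σ
  ... | V , ρ , eq = V , x ∷ʳ ρ , eq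
  pullback-map h (x ∷ xs) (refl ∷ σ) with pullback-map h xs σ
  ... | V , ρ , eq = x ∷ V , refl ∷ ρ , cong (h x ∷_) eq

weightSum : {A : Set} → (A → ℚ) → List A → ℚ
weightSum w = foldr (λ x acc → w x ℚ.+ acc) 0ℚ

weightSum-complement : {A : Set} (w : A → ℚ) {V S : List A} (τ : V ⊆ S) →
  weightSum w S ≡ weightSum w V ℚ.+ weightSum w (complement τ)
weightSum-complement w [] = sym (ℚP.+-identityˡ 0ℚ)
weightSum-complement w {V} (y ∷ʳ τ) =
  trans (cong (w y ℚ.+_) (weightSum-complement w τ))
    (x∙yz≈y∙xz (CommutativeMonoid.commutativeSemigroup ℚP.+-0-commutativeMonoid) (w y) (weightSum w V) _)
weightSum-complement w {x ∷ V} (refl ∷ τ) =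
  trans (cong (w x ℚ.+_) (weightSum-complement w τ)) (sym (ℚP.+-assoc (w x) (weightSum w V) _))

weightSum-unit-bound : {A : Set} (w : A → ℚ) (l d : ℕ) (V : List A) →
  All (λ g → w g ≡ ℤ.+ 1 ℚ./ suc l) V → length V * suc d ≤ suc l → weightSum w V ℚ.≤ ℤ.+ 1 ℚ./ suc d
weightSum-unit-bound w l d V unit bound = ℚP.toℚᵘ-cancel-≤
  (ℚᵘP.≤-respˡ-≃ (ℚᵘP.≃-sym (exact V unit))
    (ℚᵘP.≤-respʳ-≃ (ℚᵘP.≃-sym (unit-toℚᵘ d)) (*≤* (subst₂ ℤ._≤_ (ℤP.pos-* (length V) (suc d)) (sym (ℤP.*-identityˡ _)) (ℤ.+≤+ bound)))))
  where
  unit-toℚᵘ : ∀ m → toℚᵘ (ℤ.+ 1 ℚ./ suc m) ℚᵘ.≃ mkℚᵘ (ℤ.+ 1) m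
  unit-toℚᵘ m = ℚP.toℚᵘ-fromℚᵘ (mkℚᵘ (ℤ.+ 1) m)
  add-unit : ∀ c → (mkℚᵘ (ℤ.+ 1) l ℚᵘ.+ mkℚᵘ (ℤ.+ c) l) ℚᵘ.≃ mkℚᵘ (ℤ.+ suc c) l
  add-unit c = *≡* (ring-identity (ℤ.+ suc l) (ℤ.+ c))
    where
    ring-identity : ∀ (N C : ℤ) → (ℤ.+ 1 ℤ.* N ℤ.+ C ℤ.* N) ℤ.* N ≡ (ℤ.+ 1 ℤ.+ C) ℤ.* (N ℤ.* N)
    ring-identity = solve-∀
  exact : ∀ V → All (λ g → w g ≡ ℤ.+ 1 ℚ./ suc l) V → toℚᵘ (weightSum w V) ℚᵘ.≃ mkℚᵘ (ℤ.+ length V) l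
  exact [] [] = *≡* refl
  exact (g ∷ V) (wg ∷ unit) =
    ℚᵘP.≃-trans (ℚP.toℚᵘ-homo-+ (w g) (weightSum w V))
      (ℚᵘP.≃-trans (ℚᵘP.+-cong (ℚᵘP.≃-trans (ℚP.toℚᵘ-cong wg) (unit-toℚᵘ l)) (exact V unit))
        (add-unit (length V)))

-- Sums of subsequences and the compression lemma for dense sequences

coordSum : (ms : List ℕ) → Fin (length ms) → Seq ms → ℕ
coordSum ms x = sumOver (λ g → toℕ (g x))

sumElem : (ms : List ℕ) → (∀ x → NonZero (lookup ms x)) → Seq ms → Elem ms
sumElem ms nz V x = fromℕ< (m%n<n (coordSum ms x V) (lookup ms x) {{nz x}})

toℕ-sumElem : ∀ ms nz V x → toℕ (sumElem ms nz V x) ≡ _%_ (coordSum ms x V) (lookup ms x) {{nz x}}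
toℕ-sumElem ms nz V x = toℕ-fromℕ< _

-- Replacing a nonempty subsequence V of a zero-sum free S by σ(V) keeps it zero-sum
-- free: a zero-sum subsequence through σ(V) yields one of S through V.
replace-zeroSumFree : ∀ ms nz {V S : Seq ms} → ZeroSumFree ms S → (τ : V ⊆ S) → NonEmpty V →
  ZeroSumFree ms (sumElem ms nz V ∷ complement τ)
replace-zeroSumFree ms nz zsf τ neV T (_ ∷ʳ ρ) neT zsT = zsf T (⊆-trans ρ (complement-⊆ τ)) neT zsT
replace-zeroSumFree ms nz {V} zsf τ neV (_ ∷ T) (refl ∷ ρ) _ zsT with recombine τ ρ
... | R , ρR , V≤R , sums = zsf R ρR (≤-trans neV V≤R) λ x →
  subst (lookup ms x ∣_) (sym (sums (λ g → toℕ (g x))))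
    (∣-%-+ (coordSum ms x V) (coordSum ms x T) (lookup ms x) {{nz x}}
      (subst (λ z → lookup ms x ∣ z + coordSum ms x T) (toℕ-sumElem ms nz V x) (zsT x)))

-- Otherwise σ(V) ∷ (S ∖ V) is zero-sum free, has cross
-- number at least k(S) = k(G), and is shorter than S.
dense-incompressible : ∀ ms nz {V S : Seq ms} (l : ℕ) → Dense ms S → (τ : V ⊆ S) → 2 ≤ length V →
  All (λ g → ord ms g ≡ suc l) V → length V * ord ms (sumElem ms nz V) ≤ suc l → ⊥
dense-incompressible ms nz {V} {S} l (zsf , maximal , minimal) τ 2≤V ords bound =
  <-irrefl refl (≤-trans S′<S (minimal S′ zsf′ (ℚP.≤-antisym (maximal S′ zsf′) S≤S′)))
  where
  σ : Elem ms
  σ = sumElem ms nz V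
  W S′ : Seq ms
  W = complement τ
  S′ = σ ∷ W
  zsf′ : ZeroSumFree ms S′
  zsf′ = replace-zeroSumFree ms nz zsf τ (≤-trans (s≤s z≤n) 2≤V)
  weight : Elem ms → ℚ
  weight g = ℤ.+ 1 ℚ./ ord ms g
  V≤σ : weightSum weight V ℚ.≤ weight σ
  V≤σ = weightSum-unit-bound weight l (ordSearch ms σ (product ms) 0) V
    (All.map (λ o → cong (λ z → ℤ.+ 1 ℚ./ suc z) (suc-injective o)) ords) bound
  S≤S′ : cross ms S ℚ.≤ cross ms S′
  S≤S′ = subst (ℚ._≤ cross ms S′) (sym (weightSum-complement weight τ)) (ℚP.+-monoˡ-≤ (weightSum weight W) V≤σ)
  S′<S : suc (length S′) ≤ length S
  S′<S = ≤-trans (+-monoˡ-≤ (length W) 2≤V) (≤-reflexive (sym (length-complement τ)))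

-- The projection to C_p^n

PInsensitive : (ms : List ℕ) (p L : ℕ) → Fin (length ms) → Set
PInsensitive ms p L x = ∀ t → lookup ms x ∣ (L * p) * t → lookup ms x ∣ L * t

∣L⇒PInsensitive : ∀ ms p L x → lookup ms x ∣ L → PInsensitive ms p L x
∣L⇒PInsensitive ms p L x m∣L t _ = ∣m⇒∣m*n t m∣L

lookup-replicate′ : ∀ n {A : Set} (c : A) (y : Fin (length (replicate n c))) → lookup (replicate n c) y ≡ c
lookup-replicate′ (suc n) c zero = refl
lookup-replicate′ (suc n) c (suc y) = lookup-replicate′ n c y

module Projection (ms : List ℕ) (p : ℕ) (1<p : 1 < p) (n L : ℕ) {{L≢0 : NonZero L}}
  (pos : Fin n → Fin (length ms)) (b : Fin n → ℕ)
  (pos-modulus : ∀ j → lookup ms (pos j) ≡ p ^ suc (b j))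
  (classify : ∀ x → PInsensitive ms p L x ⊎ ∃ λ j → pos j ≡ x) where

  instance
    p≢0 : NonZero p
    p≢0 = >-nonZero (<-trans z<s 1<p)
    p^b≢0 : {j : Fin n} → NonZero (p ^ b j)
    p^b≢0 {j} = m^n≢0 p (b j)
    Lp≢0 : NonZero (L * p)
    Lp≢0 = m*n≢0 L p

  -- The j-th digit of g, ⌊L·g_{pos j} / p^{b_j}⌋; the division is exact when (L·p)·g = 0.
  digit : Elem ms → Fin n → ℕ
  digit g j = L * toℕ (g (pos j)) / p ^ b j

  ψ : Elem ms → Elem (Cpn p n)
  ψ g y = cast (sym (lookup-replicate′ n p y)) (fromℕ< (m%n<n (digit g (cast (length-replicate n) y)) p))

  toℕ-ψ : ∀ g j → toℕ (ψ g (cast (sym (length-replicate n)) j)) ≡ digit g j % p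
  toℕ-ψ g j = trans (toℕ-cast _ _) (trans (toℕ-fromℕ< _) (cong (λ i → digit g i % p) (cast-involutive (length-replicate n) (sym (length-replicate n)) j)))

  -- If (L·p)·g = 0 then p·p^{b_j} ∣ p·(L·g_{pos j}), so L·g_{pos j} = p^{b_j} · digit g j.
  digit-exact : ∀ g j → Annihilates ms g (L * p) → L * toℕ (g (pos j)) ≡ p ^ b j * digit g j
  digit-exact g j an =
    sym (m*[n/m]≡n (*-cancelˡ-∣ p (subst₂ _∣_ (pos-modulus j) (*-pull-middle L p (toℕ (g (pos j)))) (an (pos j)))))

  digit-sum-divisible : ∀ V → ZeroSum (Cpn p n) (map ψ V) → ∀ j → p ∣ sumOver (λ g → digit g j) V
  digit-sum-divisible V zs j = ∣-sum-of-residues (λ g → digit g j) V p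
    (subst₂ _∣_ (lookup-replicate′ n p y)
      (trans (sumOver-map (λ h → toℕ (h y)) ψ V) (sumOver-cong V (All.tabulate λ {g} _ → toℕ-ψ g j)))
      (zs y))
    where
    y : Fin (length (replicate n p))
    y = cast (sym (length-replicate n)) j

  -- If L·p kills every term of V and ψ(V) is a zero-sum sequence, then L kills Σ V:
  -- on p-insensitive factors directly, on the factor pos j since its digit sum is ≡ 0 mod p.
  L-annihilates-coordSum : ∀ V → All (λ g → Annihilates ms g (L * p)) V → ZeroSum (Cpn p n) (map ψ V) →
    ∀ x → lookup ms x ∣ L * coordSum ms x V
  L-annihilates-coordSum V an zs x with classify x
  ... | inj₁ insensitive = insensitive (coordSum ms x V)
    (subst (lookup ms x ∣_) (sumOver-*ˡ (L * p) (λ g → toℕ (g x)) V) (sumOver-∣ _ V (All.map (λ a → a x) an)))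
  ... | inj₂ (j , refl) = subst₂ _∣_ (sym (pos-modulus j)) (sym L·coordSum)
    (subst (_∣ p ^ b j * sumOver (λ g → digit g j) V) (*-comm (p ^ b j) p) (*-monoʳ-∣ (p ^ b j) (digit-sum-divisible V zs j)))
    where
    L·coordSum : L * coordSum ms (pos j) V ≡ p ^ b j * sumOver (λ g → digit g j) V
    L·coordSum = begin
      L * coordSum ms (pos j) V              ≡⟨ sumOver-*ˡ L (λ g → toℕ (g (pos j))) V ⟨
      sumOver (λ g → L * toℕ (g (pos j))) V  ≡⟨ sumOver-cong V (All.map (λ {g} → digit-exact g j) an) ⟩
      sumOver (λ g → p ^ b j * digit g j) V  ≡⟨ sumOver-*ˡ (p ^ b j) (λ g → digit g j) V ⟩
      p ^ b j * sumOver (λ g → digit g j) V  ∎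
      where open ≡-Reasoning

  -- The same for the reduced sum σ(V), since reducing coordinates mod m_x keeps m_x ∣ L·(·).
  sumElem-annihilated : ∀ nz V → All (λ g → Annihilates ms g (L * p)) V → ZeroSum (Cpn p n) (map ψ V) →
    Annihilates ms (sumElem ms nz V) L
  sumElem-annihilated nz V an zs x = subst (λ t → lookup ms x ∣ L * t) (sym (toℕ-sumElem ms nz V x))
    (∣-*-% L (coordSum ms x V) (lookup ms x) {{nz x}} (L-annihilates-coordSum V an zs x))

  -- In a dense S, ψ sends no nonempty subsequence of at most p terms of order L·p to a
  -- zero-sum sequence: one term would be killed by L < L·p, and two or more could be
  -- compressed into their sum, whose order is at most L.
  no-short-zero-sum : ∀ {S} → Dense ms S → (V : Seq ms) → V ⊆ S → All (λ g → ord ms g ≡ L * p) V →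
    NonEmpty V → length V ≤ p → ¬ ZeroSum (Cpn p n) (map ψ V)
  no-short-zero-sum dense (g ∷ []) τ ords@(ord-g ∷ []) _ _ zs =
    <-irrefl ord-g (≤-<-trans (ord-minimal ms g L g-killed) (m<m*n L p 1<p))
    where
    nz = nonZeroModuli ms g
    g-killed : Annihilates ms g L
    g-killed x = subst (λ t → lookup ms x ∣ L * t)
      (trans (toℕ-sumElem ms nz (g ∷ []) x)
        (trans (cong (λ t → _%_ t (lookup ms x) {{nz x}}) (+-identityʳ (toℕ (g x))))
          (m<n⇒m%n≡m {{nz x}} (toℕ<n (g x)))))
      (sumElem-annihilated nz (g ∷ []) (All.map (λ {h} → ord≡⇒annihilates ms h) ords) zs x)
  no-short-zero-sum dense V@(g ∷ _ ∷ _) τ ords _ |V|≤p zs =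
    dense-incompressible ms nz (pred (L * p)) dense τ (s≤s (s≤s z≤n))
      (All.map (λ o → trans o (sym (suc-pred (L * p)))) ords)
      (≤-trans (*-mono-≤ |V|≤p (ord-minimal ms (sumElem ms nz V) L σ-killed))
        (≤-reflexive (trans (*-comm p L) (sym (suc-pred (L * p))))))
    where
    nz = nonZeroModuli ms g
    σ-killed : Annihilates ms (sumElem ms nz V) L
    σ-killed = sumElem-annihilated nz V (All.map (λ {h} → ord≡⇒annihilates ms h) ords) zs

  ofOrder : Seq ms → Seq ms
  ofOrder S = filter (λ g → ord ms g ≟ L * p) S

  -- A dense sequence has fewer than t terms of order L·p, for every t with the
  -- η-property of C_p^n: otherwise their ψ-image would contain a short zero-sum sequence.
  countOrd-bound : ∀ S → Dense ms S → ∀ t → EtaProp p n t → countOrd ms S (L * p) ≤ t ∸ 1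
  countOrd-bound S dense t eta with t ≤? countOrd ms S (L * p)
  ... | no t≰count = ∸-monoˡ-≤ 1 (≰⇒> t≰count)
  ... | yes t≤count with eta (map ψ (ofOrder S)) (subst (t ≤_) (sym (length-map ψ (ofOrder S))) t≤count)
  ...   | U , U⊆ , neU , |U|≤p , zsU with pullback-map ψ (ofOrder S) U⊆
  ...     | V , V⊆ , refl = ⊥-elim (no-short-zero-sum dense V (⊆-trans V⊆ (filter-⊆ _ S))
    (All-resp-⊆ V⊆ (all-filter _ S)) (subst (1 ≤_) (length-map ψ V) neU)
    (subst (_≤ p) (length-map ψ V) |U|≤p) zsU)

module _ {B : Set} where

  inject-left : (xs ys : List B) → Fin (length xs) → Fin (length (xs ++ ys))
  inject-left (x ∷ xs) ys zero = zero
  inject-left (x ∷ xs) ys (suc i) = suc (inject-left xs ys i)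

  inject-right : (xs ys : List B) → Fin (length ys) → Fin (length (xs ++ ys))
  inject-right [] ys i = i
  inject-right (x ∷ xs) ys i = suc (inject-right xs ys i)

  split-position : (xs ys : List B) → Fin (length (xs ++ ys)) → Fin (length xs) ⊎ Fin (length ys)
  split-position [] ys i = inj₂ i
  split-position (x ∷ xs) ys zero = inj₁ zero
  split-position (x ∷ xs) ys (suc i) with split-position xs ys i
  ... | inj₁ j = inj₁ (suc j)
  ... | inj₂ j = inj₂ j

  split-position-inverse : (xs ys : List B) (i : Fin (length (xs ++ ys))) →
    [ inject-left xs ys , inject-right xs ys ] (split-position xs ys i) ≡ i
  split-position-inverse [] ys i = refl
  split-position-inverse (x ∷ xs) ys zero = refl
  split-position-inverse (x ∷ xs) ys (suc i) with split-position xs ys i | split-position-inverse xs ys i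
  ... | inj₁ j | eq = cong suc eq
  ... | inj₂ j | eq = cong suc eq

  lookup-inject-left : (xs ys : List B) (i : Fin (length xs)) → lookup (xs ++ ys) (inject-left xs ys i) ≡ lookup xs i
  lookup-inject-left (x ∷ xs) ys zero = refl
  lookup-inject-left (x ∷ xs) ys (suc i) = lookup-inject-left xs ys i

  lookup-inject-right : (xs ys : List B) (i : Fin (length ys)) → lookup (xs ++ ys) (inject-right xs ys i) ≡ lookup ys i
  lookup-inject-right [] ys i = refl
  lookup-inject-right (x ∷ xs) ys i = lookup-inject-right xs ys i

module _ {A B : Set} (f : A → List B) where

  blockPos : ∀ r (h : Fin r → A) (a : Fin r) → Fin (length (f (h a))) → Fin (length (concatMap f (tabulate h)))
  blockPos (suc r) h zero β = inject-left (f (h zero)) _ β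
  blockPos (suc r) h (suc a) β = inject-right (f (h zero)) _ (blockPos r (λ z → h (suc z)) a β)

  blockOf : ∀ r (h : Fin r → A) → Fin (length (concatMap f (tabulate h))) → Σ (Fin r) λ a → Fin (length (f (h a)))
  blockOf (suc r) h x with split-position (f (h zero)) (concatMap f (tabulate (λ z → h (suc z)))) x
  ... | inj₁ β = zero , β
  ... | inj₂ y with blockOf r (λ z → h (suc z)) y
  ...   | a , β = suc a , β

  blockPos-blockOf : ∀ r (h : Fin r → A) x → blockPos r h (proj₁ (blockOf r h x)) (proj₂ (blockOf r h x)) ≡ x
  blockPos-blockOf (suc r) h x with split-position (f (h zero)) (concatMap f (tabulate (λ z → h (suc z)))) x
                                  | split-position-inverse (f (h zero)) (concatMap f (tabulate (λ z → h (suc z)))) x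
  ... | inj₁ β | eq = eq
  ... | inj₂ y | eq with blockOf r (λ z → h (suc z)) y | blockPos-blockOf r (λ z → h (suc z)) y
  ...   | a , β | eq′ = trans (cong (inject-right (f (h zero)) _) eq′) eq

  lookup-blockPos : ∀ r (h : Fin r → A) a β → lookup (concatMap f (tabulate h)) (blockPos r h a β) ≡ lookup (f (h a)) β
  lookup-blockPos (suc r) h zero β = lookup-inject-left (f (h zero)) _ β
  lookup-blockPos (suc r) h (suc a) β =
    trans (lookup-inject-right (f (h zero)) _ _) (lookup-blockPos r (λ z → h (suc z)) a β)

lookup-map-applyUpTo : ∀ (g u : ℕ → ℕ) m (β : Fin (length (map g (applyUpTo u m)))) →
  lookup (map g (applyUpTo u m)) β ≡ g (u (toℕ β)) × toℕ β < m
lookup-map-applyUpTo g u (suc m) zero = refl , s≤s z≤n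
lookup-map-applyUpTo g u (suc m) (suc β) with lookup-map-applyUpTo g (λ z → u (suc z)) m β
... | eq , β<m = eq , s≤s β<m

applyUpTo-position : ∀ (g u : ℕ → ℕ) m j → j < m → Σ (Fin (length (map g (applyUpTo u m)))) λ β → toℕ β ≡ j
applyUpTo-position g u (suc m) zero _ = zero , refl
applyUpTo-position g u (suc m) (suc j) (s≤s j<m) with applyUpTo-position g (λ z → u (suc z)) m j j<m
... | β , eq = suc β , cong suc eq

prime-power-cancel : ∀ {q P} → Prime q → Prime P → q ≢ P → ∀ e X → q ^ e ∣ P * X → q ^ e ∣ X
prime-power-cancel pq pP q≢P zero X _ = 1∣ X
prime-power-cancel {q} {P} pq pP q≢P (suc e) X q^e+1∣PX
  with euclidsLemma P X pq (m*n∣⇒m∣ q (q ^ e) q^e+1∣PX)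
... | inj₁ q∣P with prime⇒irreducible pP q∣P
...   | inj₁ q≡1 = ⊥-elim (nonTrivial⇒≢1 {{prime⇒nonTrivial pq}} q≡1)
...   | inj₂ q≡P = ⊥-elim (q≢P q≡P)
prime-power-cancel {q} {P} pq pP q≢P (suc e) X q^e+1∣PX | inj₂ (divides Y refl) =
  subst (q * q ^ e ∣_) (*-comm q Y) (*-monoʳ-∣ q q^e∣Y)
  where
  instance
    q≢0 : NonZero q
    q≢0 = prime⇒nonZero pq
  q^e∣Y : q ^ e ∣ Y
  q^e∣Y = prime-power-cancel pq pP q≢P e Y
    (*-cancelˡ-∣ q (subst (q * q ^ e ∣_) (trans (sym (*-assoc P Y q)) (*-comm (P * Y) q)) q^e+1∣PX))

^-∣-^ : ∀ m {a c} → a ≤ c → m ^ a ∣ m ^ c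
^-∣-^ m {a} {c} a≤c = divides (m ^ (c ∸ a)) (begin
  m ^ c               ≡⟨ cong (m ^_) (m+[n∸m]≡n a≤c) ⟨
  m ^ (a + (c ∸ a))   ≡⟨ ^-distribˡ-+-* m a (c ∸ a) ⟩
  m ^ a * m ^ (c ∸ a) ≡⟨ *-comm (m ^ a) _ ⟩
  m ^ (c ∸ a) * m ^ a ∎)
  where open ≡-Reasoning

antitone : (f : ℕ → ℕ) → (∀ j → 1 ≤ j → f (suc j) ≤ f j) → ∀ {j j′} → 1 ≤ j → j ≤ j′ → f j′ ≤ f j
antitone f step {j} 1≤j j≤j′ = subst (λ z → f z ≤ f j) (m+[n∸m]≡n j≤j′) (from-j (_ ∸ j))
  where
  from-j : ∀ d → f (j + d) ≤ f j
  from-j zero = ≤-reflexive (cong f (+-identityʳ j))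
  from-j (suc d) = ≤-trans (≤-reflexive (cong f (+-suc j d)))
    (≤-trans (step (j + d) (≤-trans 1≤j (m≤m+n j d))) (from-j d))

-- The canonical form: the first n factors of the p_i-block are the distinguished
-- factors, and for p_i^c ∣ L every other factor is p_i-insensitive.
module Canonical (r : ℕ) (p : Fin r → ℕ) (k : Fin r → ℕ) (a : Fin r → ℕ → ℕ)
  (prime : ∀ i → Prime (p i))
  (increasing : ∀ i i′ → i Data.Fin.< i′ → p i < p i′)
  (a-pos : ∀ i j → 1 ≤ j → j ≤ k i → 1 ≤ a i j)
  (a-dec : ∀ i j → 1 ≤ j → a i (suc j) ≤ a i j)
  (a-zero : ∀ i j → k i < j → a i j ≡ 0)
  (n : ℕ) (i : Fin r) (jump : a i (suc n) < a i n) where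

  ms : List ℕ
  ms = canonMods r p k a

  block : Fin r → List ℕ
  block i′ = map (λ j → p i′ ^ a i′ (suc j)) (upTo (k i′))

  lookup-ms : ∀ i′ β → lookup ms (blockPos block r id i′ β) ≡ p i′ ^ a i′ (suc (toℕ β))
  lookup-ms i′ β = trans (lookup-blockPos block r id i′ β)
    (proj₁ (lookup-map-applyUpTo (λ j → p i′ ^ a i′ (suc j)) id (k i′) β))

  P c : ℕ
  P = p i
  c = a i (suc n)

  other-prime : ∀ i′ → i′ ≢ i → p i′ ≢ P
  other-prime i′ i′≢i with <-cmpᶠ i′ i
  ... | tri< i′<i _ _ = <⇒≢ (increasing i′ i i′<i)
  ... | tri≈ _ i′≡i _ = ⊥-elim (i′≢i i′≡i)
  ... | tri> _ _ i<i′ = ≢-sym (<⇒≢ (increasing i i′ i<i′))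

  -- The jump a_{i,n} > a_{i,n+1} ≥ 0 forces n ≤ k_i.
  n≤k : n ≤ k i
  n≤k with n ≤? k i
  ... | yes n≤k = n≤k
  ... | no n≰k = ⊥-elim (n≮0 (<-≤-trans jump (≤-reflexive (a-zero i n (≰⇒> n≰k)))))

  blockIndex : (j : Fin n) → Σ (Fin (length (block i))) λ β → toℕ β ≡ toℕ j
  blockIndex j = applyUpTo-position (λ j → P ^ a i (suc j)) id (k i) (toℕ j) (<-≤-trans (toℕ<n j) n≤k)

  position : Fin n → Fin (length ms)
  position j = blockPos block r id i (proj₁ (blockIndex j))

  exponent : Fin n → ℕ
  exponent j = pred (a i (suc (toℕ j)))

  position-modulus : ∀ j → lookup ms (position j) ≡ P ^ suc (exponent j)
  position-modulus j = begin
    lookup ms (position j)      ≡⟨ lookup-ms i β ⟩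
    P ^ a i (suc (toℕ β))       ≡⟨ cong (λ z → P ^ a i (suc z)) (proj₂ (blockIndex j)) ⟩
    P ^ a i (suc (toℕ j))       ≡⟨ cong (P ^_) (suc-pred (a i (suc (toℕ j))) {{>-nonZero a≥1}}) ⟨
    P ^ suc (exponent j)        ∎
    where
    open ≡-Reasoning
    β = proj₁ (blockIndex j)
    a≥1 : 1 ≤ a i (suc (toℕ j))
    a≥1 = a-pos i (suc (toℕ j)) (s≤s z≤n) (<-≤-trans (toℕ<n j) n≤k)

  late-exponent : (β : Fin (length (block i))) → n ≤ toℕ β → a i (suc (toℕ β)) ≤ c
  late-exponent β n≤β = antitone (a i) (a-dec i) (s≤s z≤n) (s≤s n≤β)

  module _ (L : ℕ) (P^c∣L : P ^ c ∣ L) where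

    classify-blockPos : ∀ i′ β → let x = blockPos block r id i′ β in
      PInsensitive ms P L x ⊎ ∃ λ j → position j ≡ x
    classify-blockPos i′ β with i′ Data.Fin.≟ i
    ... | no i′≢i = inj₁ λ t m∣LPt → subst (_∣ L * t) (sym (lookup-ms i′ β))
      (prime-power-cancel (prime i′) (prime i) (other-prime i′ i′≢i) (a i′ (suc (toℕ β))) (L * t)
        (subst₂ _∣_ (lookup-ms i′ β) (*-pull-middle L P t) m∣LPt))
    ... | yes refl with toℕ β <? n
    ...   | yes β<n = inj₂ (fromℕ< β<n , cong (blockPos block r id i)
      (toℕ-injective (trans (proj₂ (blockIndex (fromℕ< β<n))) (toℕ-fromℕ< β<n))))
    ...   | no β≮n = inj₁ (∣L⇒PInsensitive ms P L (blockPos block r id i β)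
      (∣-trans (subst (_∣ P ^ c) (sym (lookup-ms i β)) (^-∣-^ P (late-exponent β (≮⇒≥ β≮n)))) P^c∣L))

    classify : ∀ x → PInsensitive ms P L x ⊎ ∃ λ j → position j ≡ x
    classify x = subst (λ z → PInsensitive ms P L z ⊎ ∃ λ j → position j ≡ z)
      (blockPos-blockOf block r id x) (classify-blockPos (proj₁ d) (proj₂ d))
      where
      d = blockOf block r id x

lemma17 : (r : ℕ) (p : Fin r → ℕ) (k : Fin r → ℕ) (a : Fin r → ℕ → ℕ) →
    (∀ i → Prime (p i)) →
    (∀ i i′ → i Data.Fin.< i′ → p i Data.Nat.< p i′) →
    (∀ i → 1 ≤ k i) →
    (∀ i j → 1 ≤ j → j ≤ k i → 1 ≤ a i j) →
    (∀ i j → 1 ≤ j → a i (suc j) ≤ a i j) →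
    (∀ i j → k i Data.Nat.< j → a i j ≡ 0) →
    (n : ℕ) → 1 ≤ n →
    (i : Fin r) → a i (suc n) Data.Nat.< a i n →
    (l : ℕ) → 1 ≤ l → p i ^ (a i (suc n) + 1) ∣ l →
    (S : Seq (canonMods r p k a)) → Dense (canonMods r p k a) S →
    (e : ℕ) → IsEta (p i) n e →
    countOrd (canonMods r p k a) S l ≤ e ∸ 1
lemma17 r p k a prime increasing _ a-pos a-dec a-zero n _ i jump l l≥1 (divides t l≡t·P^[c+1]) S dense e (eta , _) =
  subst (λ z → countOrd ms S z ≤ e ∸ 1) (sym l≡L·P) (countOrd-bound S dense e eta)
  where
  open Canonical r p k a prime increasing a-pos a-dec a-zero n i jump
  -- l = L·P with L = t·P^c, so P^c ∣ L and L ≠ 0.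
  L : ℕ
  L = t * P ^ c
  l≡L·P : l ≡ L * P
  l≡L·P = begin
    l                  ≡⟨ l≡t·P^[c+1] ⟩
    t * P ^ (c + 1)    ≡⟨ cong (λ z → t * P ^ z) (+-comm c 1) ⟩
    t * (P * P ^ c)    ≡⟨ cong (t *_) (*-comm P (P ^ c)) ⟩
    t * (P ^ c * P)    ≡⟨ *-assoc t (P ^ c) P ⟨
    L * P              ∎
    where open ≡-Reasoning
  instance
    L≢0 : NonZero L
    L≢0 = m*n≢0⇒m≢0 L {{subst NonZero l≡L·P (>-nonZero l≥1)}}
  open Projection ms P (nonTrivial⇒n>1 P {{prime⇒nonTrivial (prime i)}}) n L
    position exponent position-modulus (classify L (n∣m*n t))
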